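{- For every positive integer $n$, $\mathrm{mp}(P_n \Box P_3) = \left\lfloor \frac{n}{2} \right\rfloor$ if $n \equiv 0 \pmod 4$, and $\mathrm{mp}(P_n \Box P_3) = \left\lfloor \frac{n}{2} \right\rfloor + 1$ if $n \equiv 1, 2, 3 \pmod 4$.
   Context: $P_n \Box P_3$ denotes the Cartesian product of the path on $n$ vertices with the path on $3$ vertices. For a graph $G$ with shortest-path distance $d$, let $N_r(v) = \{u : d(u,v) \leq r\}$. A multipacking of $G$ is a set $M \subseteq V(G)$ such that for every vertex $v$ and every positive integer $r$, $|N_r(v) \cap M| \leq r$; $\mathrm{mp}(G)$ is the maximum size of a multipacking of $G$. -}

module Defs where

open import Data.Nat using (ℕ; zero; suc; _≤_)
open import Data.Fin using (Fin; toℕ)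
open import Data.Product using (_×_; Σ; _,_)
open import Data.Sum using (_⊎_)
open import Data.List using (List; length)
open import Data.List.Relation.Unary.All using (All)
open import Data.List.Relation.Unary.Unique.Propositional using (Unique)
open import Data.List.Membership.Propositional using (_∈_)
open import Relation.Binary.PropositionalEquality using (_≡_)

PathAdj : (n : ℕ) → Fin n → Fin n → Set
PathAdj n i j = (toℕ i ≡ suc (toℕ j)) ⊎ (toℕ j ≡ suc (toℕ i))

BoxAdj : {A B : Set} → (A → A → Set) → (B → B → Set) → A × B → A × B → Set
BoxAdj adjA adjB (a , b) (a' , b') = (a ≡ a' × adjB b b') ⊎ (b ≡ b' × adjA a a')

Grid3 : ℕ → Set
Grid3 n = Fin n × Fin 3

Grid3Adj : (n : ℕ) → Grid3 n → Grid3 n → Set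
Grid3Adj n = BoxAdj (PathAdj n) (PathAdj 3)

-- WithinDist adj r u v  :⇔  d(u,v) ≤ r  (there is a walk from u to v of length ≤ r),
-- where d is the shortest-path distance.
data WithinDist {V : Set} (adj : V → V → Set) : ℕ → V → V → Set where
  here : ∀ {r u} → WithinDist adj r u u
  step : ∀ {r u w v} → adj u w → WithinDist adj r w v → WithinDist adj (suc r) u v

-- A finite set of vertices is represented by a duplicate-free list.
-- M is a multipacking: for every vertex v and r ≥ 1, |N_r(v) ∩ M| ≤ r, i.e.
-- every duplicate-free list of vertices lying in N_r(v) ∩ M has length ≤ r.
IsMultipacking : {V : Set} → (V → V → Set) → List V → Set
IsMultipacking {V} adj M =
  Unique M ×
  (∀ (v : V) (r : ℕ) → 1 ≤ r → (L : List V) → Unique L →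
     All (λ u → (u ∈ M) × WithinDist adj r v u) L → length L ≤ r)

MpIs : {V : Set} → (V → V → Set) → ℕ → Set
MpIs {V} adj k =
  Σ (List V) (λ M → IsMultipacking adj M × length M ≡ k) ×
  (∀ (M : List V) → IsMultipacking adj M → length M ≤ k)

module Submission where

-- Upper bound (module UpperBound): in a multipacking M a ball of radius r holds at most r
-- vertices. So one column holds at most one vertex of M, two or three consecutive columns at
-- most two, and, by a finite check on P_4 □ P_3 (block-crowded), so do four consecutive
-- columns; cutting the columns into blocks of four gives |M| ≤ mpBound n.
--
-- Lower bound (module Construction): the vertices (4k, 0) and (4k + 1, 2) form a multipacking
-- of size mpBound n. In the rotated coordinates σ = col + row, τ = col + (2 - row) a ball of
-- radius r lies in a square box of radius r, and a box of radius r holds at most r of these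
-- vertices (box-bound): directly for r = 1, 2, and for r + 2 by splitting the box into an inner
-- box of radius r and a fringe holding at most one marked vertex of each of the two kinds.

open import Defs
open import Data.Nat using (ℕ; zero; suc; _+_; _*_; _∸_; _≤_; _<_; z≤n; s≤s; s≤s⁻¹; ∣_-_∣; _≤?_)
open import Data.Nat.Properties
open import Data.Nat.DivMod using (_/_; _%_; [m+n]%n≡m%n; m/n≡1+[m∸n]/n)
open import Data.Nat.Tactic.RingSolver using (solve-∀)
open import Data.Fin using (Fin; zero; suc; toℕ; fromℕ<) renaming (_≟_ to _≟ᶠ_)
open import Data.Fin.Properties using (toℕ-injective; toℕ<n; toℕ-fromℕ<) renaming (all? to allᶠ?; any? to anyᶠ?)
open import Data.Product using (_×_; _,_; proj₁; proj₂; ∃)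
open import Data.Product.Properties using (≡-dec)
open import Data.Sum using (_⊎_; inj₁; inj₂)
open import Data.List using (List; []; _∷_; length; filter)
open import Data.List.Membership.Propositional using (_∈_)
open import Data.List.Relation.Unary.All as All using (All; []; _∷_)
open import Data.List.Relation.Unary.All.Properties as AllP using (all-filter)
open import Data.List.Relation.Unary.AllPairs using ([]; _∷_)
open import Data.List.Relation.Unary.Unique.Propositional using (Unique)
import Data.List.Relation.Unary.Unique.Propositional.Properties as UniqueP
open import Data.Empty using (⊥; ⊥-elim)
open import Relation.Nullary using (¬_; Dec; yes; no)
open import Relation.Nullary.Decidable using (_×-dec_; _⊎-dec_; map′; toWitness)
open import Relation.Unary using (Decidable)
open import Relation.Unary.Properties using (∁?)
open import Relation.Binary.PropositionalEquality
open import Relation.Binary.Definitions using (tri<; tri≈; tri>)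

-- Counting distinct elements

AtMost : {V : Set} → ℕ → (V → Set) → Set
AtMost {V} b P = (L : List V) → Unique L → All P L → length L ≤ b

module _ {V : Set} where

  AtMost-weaken : {P Q : V → Set} {b : ℕ} → (∀ {u} → P u → Q u) → AtMost b Q → AtMost b P
  AtMost-weaken P⇒Q bound L U A = bound L U (All.map P⇒Q A)

  AtMost-none : {P : V → Set} → (∀ {u} → ¬ P u) → AtMost 0 P
  AtMost-none ¬P []      _ _       = z≤n
  AtMost-none ¬P (_ ∷ _) _ (p ∷ _) = ⊥-elim (¬P p)

  at-most-one : {P : V → Set} → (∀ {x y} → x ≢ y → P x → P y → ⊥) → AtMost 1 P
  at-most-one apart []          _                _             = z≤n
  at-most-one apart (_ ∷ [])    _                _             = s≤s z≤n
  at-most-one apart (_ ∷ _ ∷ _) ((x≢y ∷ _) ∷ _) (px ∷ py ∷ _) = ⊥-elim (apart x≢y px py)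

  at-most-two : {P : V → Set} → (∀ {x y z} → x ≢ y → x ≢ z → y ≢ z → P x → P y → P z → ⊥) → AtMost 2 P
  at-most-two apart []              _ _ = z≤n
  at-most-two apart (_ ∷ [])        _ _ = s≤s z≤n
  at-most-two apart (_ ∷ _ ∷ [])    _ _ = s≤s (s≤s z≤n)
  at-most-two apart (_ ∷ _ ∷ _ ∷ _) ((x≢y ∷ x≢z ∷ _) ∷ (y≢z ∷ _) ∷ _) (px ∷ py ∷ pz ∷ _) =
    ⊥-elim (apart x≢y x≢z y≢z px py pz)

  length-filter-split : {Q : V → Set} (Q? : Decidable Q) (L : List V) →
                        length L ≡ length (filter (∁? Q?) L) + length (filter Q? L)
  length-filter-split Q? [] = refl
  length-filter-split Q? (x ∷ L) with Q? x
  ... | yes _ = trans (cong suc (length-filter-split Q? L)) (sym (+-suc _ _))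
  ... | no  _ = cong suc (length-filter-split Q? L)

  AtMost-split : {P Q : V → Set} {a b : ℕ} (Q? : Decidable Q) →
                 AtMost a (λ u → P u × ¬ Q u) → AtMost b (λ u → P u × Q u) → AtMost (a + b) P
  AtMost-split {a = a} {b} Q? bound¬Q boundQ L U A = begin
      length L                                          ≡⟨ length-filter-split Q? L ⟩
      length (filter (∁? Q?) L) + length (filter Q? L)  ≤⟨ +-mono-≤ failing passing ⟩
      a + b                                             ∎
    where
      open ≤-Reasoning
      failing : length (filter (∁? Q?) L) ≤ a
      failing = bound¬Q _ (UniqueP.filter⁺ (∁? Q?) U) (All.zip (AllP.filter⁺ (∁? Q?) A , all-filter (∁? Q?) L))
      passing : length (filter Q? L) ≤ b
      passing = boundQ _ (UniqueP.filter⁺ Q? U) (All.zip (AllP.filter⁺ Q? A , all-filter Q? L))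

module _ {V : Set} {adj : V → V → Set} where

  walk-mono : ∀ {r s u v} → WithinDist adj r u v → r ≤ s → WithinDist adj s u v
  walk-mono here       _         = here
  walk-mono (step a w) (s≤s r≤s) = step a (walk-mono w r≤s)

  walk-++ : ∀ {r s u w v} → WithinDist adj r u w → WithinDist adj s w v → WithinDist adj (r + s) u v
  walk-++ {r} {s} here w₂ = walk-mono w₂ (m≤n+m s r)
  walk-++ (step a w₁) w₂ = step a (walk-++ w₁ w₂)

module _ {A B : Set} {adjA : A → A → Set} {adjB : B → B → Set} where

  lift₁ : ∀ {r a a'} (b : B) → WithinDist adjA r a a' → WithinDist (BoxAdj adjA adjB) r (a , b) (a' , b)
  lift₁ b here       = here
  lift₁ b (step x w) = step (inj₂ (refl , x)) (lift₁ b w)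

  lift₂ : ∀ {r b b'} (a : A) → WithinDist adjB r b b' → WithinDist (BoxAdj adjA adjB) r (a , b) (a , b')
  lift₂ a here       = here
  lift₂ a (step x w) = step (inj₁ (refl , x)) (lift₂ a w)

walk-suc : ∀ {n r} {i j : Fin n} → WithinDist (PathAdj n) r i j → WithinDist (PathAdj (suc n)) r (suc i) (suc j)
walk-suc here                = here
walk-suc (step (inj₁ e) w)   = step (inj₁ (cong suc e)) (walk-suc w)
walk-suc (step (inj₂ e) w)   = step (inj₂ (cong suc e)) (walk-suc w)

from-zero : ∀ {n} (j : Fin (suc n)) → WithinDist (PathAdj (suc n)) (toℕ j) zero j
from-zero zero              = here
from-zero {suc n} (suc j)   = step (inj₂ refl) (walk-suc (from-zero j))

to-zero : ∀ {n} (j : Fin (suc n)) → WithinDist (PathAdj (suc n)) (toℕ j) j zero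
to-zero zero            = here
to-zero {suc n} (suc j) =
  walk-mono (walk-++ (walk-suc (to-zero j)) (step (inj₁ refl) here)) (≤-reflexive (+-comm (toℕ j) 1))

path-walk : ∀ {n} (i j : Fin n) → WithinDist (PathAdj n) ∣ toℕ i - toℕ j ∣ i j
path-walk zero    j       = from-zero j
path-walk (suc i) zero    = to-zero (suc i)
path-walk (suc i) (suc j) = walk-suc (path-walk i j)

-- Taxicab geometry of P_n □ P_3

col : ∀ {n} → Grid3 n → ℕ
col u = toℕ (proj₁ u)

row : ∀ {n} → Grid3 n → ℕ
row u = toℕ (proj₂ u)

dist : ∀ {n} → Grid3 n → Grid3 n → ℕ
dist u w = ∣ col u - col w ∣ + ∣ row u - row w ∣

grid-≡ : ∀ {n} {u w : Grid3 n} → col u ≡ col w → row u ≡ row w → u ≡ w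
grid-≡ {u = _ , _} {_ , _} c≡ r≡ = cong₂ _,_ (toℕ-injective c≡) (toℕ-injective r≡)

dist-self : ∀ {n} (u : Grid3 n) → dist u u ≡ 0
dist-self u = cong₂ _+_ (∣n-n∣≡0 (col u)) (∣n-n∣≡0 (row u))

dist-triangle : ∀ {n} (u w v : Grid3 n) → dist u v ≤ dist u w + dist w v
dist-triangle u w v = begin
    ∣ col u - col v ∣ + ∣ row u - row v ∣
      ≤⟨ +-mono-≤ (∣-∣-triangle (col u) (col w) (col v)) (∣-∣-triangle (row u) (row w) (row v)) ⟩
    (∣ col u - col w ∣ + ∣ col w - col v ∣) + (∣ row u - row w ∣ + ∣ row w - row v ∣)
      ≡⟨ interchange ∣ col u - col w ∣ ∣ col w - col v ∣ ∣ row u - row w ∣ ∣ row w - row v ∣ ⟩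
    (∣ col u - col w ∣ + ∣ row u - row w ∣) + (∣ col w - col v ∣ + ∣ row w - row v ∣) ∎
  where
    open ≤-Reasoning
    interchange : ∀ a c b d → (a + c) + (b + d) ≡ (a + b) + (c + d)
    interchange = solve-∀

dist⇒within : ∀ {n r} (v u : Grid3 n) → dist v u ≤ r → WithinDist (Grid3Adj n) r v u
dist⇒within (a , b) (a' , b') d≤r =
  walk-mono (walk-++ (lift₁ b (path-walk a a')) (lift₂ a' (path-walk b b'))) d≤r

∣suc-n∣≡1 : ∀ m → ∣ suc m - m ∣ ≡ 1
∣suc-n∣≡1 zero    = refl
∣suc-n∣≡1 (suc m) = ∣suc-n∣≡1 m

path-adjacent : ∀ {n} {i j : Fin n} → PathAdj n i j → ∣ toℕ i - toℕ j ∣ ≡ 1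
path-adjacent {j = j} (inj₁ i≡1+j) rewrite i≡1+j = ∣suc-n∣≡1 (toℕ j)
path-adjacent {i = i} (inj₂ j≡1+i) rewrite j≡1+i = trans (∣-∣-comm (toℕ i) _) (∣suc-n∣≡1 (toℕ i))

grid-adjacent : ∀ {n} {u w : Grid3 n} → Grid3Adj n u w → dist u w ≡ 1
grid-adjacent {u = a , _} (inj₁ (refl , adj)) = cong₂ _+_ (∣n-n∣≡0 (toℕ a)) (path-adjacent adj)
grid-adjacent {u = _ , b} (inj₂ (refl , adj)) = cong₂ _+_ (path-adjacent adj) (∣n-n∣≡0 (toℕ b))

-- dist never grows by more than one per step of a walk.
within⇒dist : ∀ {n r} {v u : Grid3 n} → WithinDist (Grid3Adj n) r v u → dist v u ≤ r
within⇒dist {v = v} here = ≤-trans (≤-reflexive (dist-self v)) z≤n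
within⇒dist {v = v} {u} (step {w = w} adj walk) =
  ≤-trans (dist-triangle v w u) (+-mono-≤ (≤-reflexive (grid-adjacent adj)) (within⇒dist walk))

∣-∣≤⇒≤ : ∀ {a b k} → ∣ a - b ∣ ≤ k → a ≤ k + b
∣-∣≤⇒≤ {a} {b} {k} h = ≤-trans (m≤n+∣m-n∣ a b) (≤-trans (+-monoʳ-≤ b h) (≤-reflexive (+-comm b k)))

∣-∣≤⇒≥ : ∀ {a b k} → ∣ a - b ∣ ≤ k → b ≤ k + a
∣-∣≤⇒≥ {a} {b} h = ∣-∣≤⇒≤ (subst (_≤ _) (∣-∣-comm a b) h)

≤⇒∣-∣≤ : ∀ {a b k} → a ≤ k + b → b ≤ k + a → ∣ a - b ∣ ≤ k
≤⇒∣-∣≤ {a} {b} {k} a≤k+b b≤k+a with ≤-total a b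
... | inj₁ a≤b = subst (_≤ k) (sym (m≤n⇒∣m-n∣≡n∸m a≤b))
                       (m≤n+o⇒m∸n≤o b a (subst (b ≤_) (+-comm k a) b≤k+a))
... | inj₂ b≤a = subst (_≤ k) (sym (m≤n⇒∣n-m∣≡n∸m b≤a))
                       (m≤n+o⇒m∸n≤o a b (subst (a ≤_) (+-comm k b) a≤k+b))

middle : ∀ {n} (c : ℕ) → c < n → Grid3 n
middle c c<n = fromℕ< c<n , suc zero

∣1-row∣≤1 : (y : Fin 3) → ∣ 1 - toℕ y ∣ ≤ 1
∣1-row∣≤1 zero             = s≤s z≤n
∣1-row∣≤1 (suc zero)       = z≤n
∣1-row∣≤1 (suc (suc zero)) = s≤s z≤n

dist-middle : ∀ {n c k} (c<n : c < n) (u : Grid3 n) → ∣ c - col u ∣ ≤ k → dist (middle c c<n) u ≤ k + 1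
dist-middle c<n u near rewrite toℕ-fromℕ< c<n = +-mono-≤ near (∣1-row∣≤1 (proj₂ u))

-- The upper bound

mpBound : ℕ → ℕ
mpBound 0                             = 0
mpBound 1                             = 1
mpBound 2                             = 2
mpBound 3                             = 2
mpBound (suc (suc (suc (suc w))))     = 2 + mpBound w

-- Distances d₁ d₂ d₃ of three vertices from a common centre that rule out all three lying in
-- one multipacking: a ball of radius 2 would contain three of them, or one of radius 1 two.
Crowded : ℕ → ℕ → ℕ → Set
Crowded d₁ d₂ d₃ =
  (d₁ ≤ 2 × d₂ ≤ 2 × d₃ ≤ 2) ⊎ (d₁ ≤ 1 × d₂ ≤ 1) ⊎ (d₁ ≤ 1 × d₃ ≤ 1) ⊎ (d₂ ≤ 1 × d₃ ≤ 1)

crowded? : ∀ d₁ d₂ d₃ → Dec (Crowded d₁ d₂ d₃)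
crowded? d₁ d₂ d₃ = (d₁ ≤? 2 ×-dec d₂ ≤? 2 ×-dec d₃ ≤? 2) ⊎-dec (d₁ ≤? 1 ×-dec d₂ ≤? 1)
                    ⊎-dec (d₁ ≤? 1 ×-dec d₃ ≤? 1) ⊎-dec (d₂ ≤? 1 ×-dec d₃ ≤? 1)

Crowded-cong : ∀ {d₁ d₂ d₃ e₁ e₂ e₃} → d₁ ≡ e₁ → d₂ ≡ e₂ → d₃ ≡ e₃ →
               Crowded d₁ d₂ d₃ → Crowded e₁ e₂ e₃
Crowded-cong refl refl refl crowded = crowded

grid-all? : {P : Grid3 4 → Set} → Decidable P → Dec (∀ c → P c)
grid-all? P? = map′ (λ h c → h (proj₁ c) (proj₂ c)) (λ h a y → h (a , y)) (allᶠ? λ a → allᶠ? λ y → P? (a , y))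

grid-any? : {P : Grid3 4 → Set} → Decidable P → Dec (∃ P)
grid-any? P? = map′ (λ { (a , y , p) → (a , y) , p }) (λ { ((a , y) , p) → a , y , p })
                    (anyᶠ? λ a → anyᶠ? λ y → P? (a , y))

CrowdedAt : (c p q s : Grid3 4) → Set
CrowdedAt c p q s = Crowded (dist c p) (dist c q) (dist c s)

Resolved : (p q s : Grid3 4) → Set
Resolved p q s = p ≡ q ⊎ p ≡ s ⊎ q ≡ s ⊎ ∃ (λ c → CrowdedAt c p q s)

resolved? : ∀ p q s → Dec (Resolved p q s)
resolved? p q s = p ≟₄ q ⊎-dec p ≟₄ s ⊎-dec q ≟₄ s ⊎-dec grid-any? (λ c → crowded? _ _ _)
  where
    _≟₄_ : (x y : Grid3 4) → Dec (x ≡ y)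
    _≟₄_ = ≡-dec _≟ᶠ_ _≟ᶠ_

every-triple-resolved : ∀ p q s → Resolved p q s
every-triple-resolved =
  toWitness {a? = grid-all? (λ p → grid-all? (λ q → grid-all? (λ s → resolved? p q s)))} _

block-crowded : (p q s : Grid3 4) → p ≢ q → p ≢ s → q ≢ s → ∃ λ c → CrowdedAt c p q s
block-crowded p q s p≢q p≢s q≢s = centre (every-triple-resolved p q s)
  where
    centre : Resolved p q s → ∃ λ c → CrowdedAt c p q s
    centre (inj₁ p≡q)                = ⊥-elim (p≢q p≡q)
    centre (inj₂ (inj₁ p≡s))         = ⊥-elim (p≢s p≡s)
    centre (inj₂ (inj₂ (inj₁ q≡s)))  = ⊥-elim (q≢s q≡s)
    centre (inj₂ (inj₂ (inj₂ found))) = found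

module UpperBound {n : ℕ} (M : List (Grid3 n)) (packing : IsMultipacking (Grid3Adj n) M) where

  ball : ∀ v r → 1 ≤ r → AtMost r (λ u → u ∈ M × dist v u ≤ r)
  ball v r 1≤r = AtMost-weaken (λ { (u∈M , d≤r) → u∈M , dist⇒within v _ d≤r }) (proj₂ packing v r 1≤r)

  pair-within₁ : ∀ v {x y} → x ≢ y → x ∈ M → y ∈ M → dist v x ≤ 1 → dist v y ≤ 1 → ⊥
  pair-within₁ v x≢y x∈M y∈M dx dy =
    n≮n 1 (ball v 1 (s≤s z≤n) (_ ∷ _ ∷ []) ((x≢y ∷ []) ∷ [] ∷ []) ((x∈M , dx) ∷ (y∈M , dy) ∷ []))

  uncrowded : ∀ {p q s} → p ≢ q → p ≢ s → q ≢ s → p ∈ M → q ∈ M → s ∈ M →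
              (v : Grid3 n) → ¬ Crowded (dist v p) (dist v q) (dist v s)
  uncrowded p≢q p≢s q≢s p∈M q∈M s∈M v (inj₁ (dp , dq , ds)) =
    n≮n 2 (ball v 2 (s≤s z≤n) (_ ∷ _ ∷ _ ∷ []) ((p≢q ∷ p≢s ∷ []) ∷ (q≢s ∷ []) ∷ [] ∷ [])
                 ((p∈M , dp) ∷ (q∈M , dq) ∷ (s∈M , ds) ∷ []))
  uncrowded p≢q p≢s q≢s p∈M q∈M s∈M v (inj₂ (inj₁ (dp , dq)))        = pair-within₁ v p≢q p∈M q∈M dp dq
  uncrowded p≢q p≢s q≢s p∈M q∈M s∈M v (inj₂ (inj₂ (inj₁ (dp , ds)))) = pair-within₁ v p≢s p∈M s∈M dp ds
  uncrowded p≢q p≢s q≢s p∈M q∈M s∈M v (inj₂ (inj₂ (inj₂ (dq , ds)))) = pair-within₁ v q≢s q∈M s∈M dq ds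

  InSlab : ℕ → ℕ → Grid3 n → Set
  InSlab lo w u = u ∈ M × lo ≤ col u × col u < lo + w

  -- One column lies in a ball of radius 1.
  slab₁ : ∀ lo → lo < n → AtMost 1 (InSlab lo 1)
  slab₁ lo lo<n = AtMost-weaken within₁ (ball (middle lo lo<n) 1 (s≤s z≤n))
    where
      within₁ : ∀ {u} → InSlab lo 1 u → u ∈ M × dist (middle lo lo<n) u ≤ 1
      within₁ {u} (u∈M , lo≤c , c<lo+1) =
        u∈M , dist-middle lo<n u (≤⇒∣-∣≤ lo≤c (s≤s⁻¹ (subst (col u <_) (+-comm lo 1) c<lo+1)))

  -- Two or three columns lie in a ball of radius 2.
  slab₂₃ : ∀ lo w → 2 ≤ w → w ≤ 3 → lo + w ≤ n → AtMost 2 (InSlab lo w)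
  slab₂₃ lo w 2≤w w≤3 fits = AtMost-weaken within₂ (ball (middle (lo + 1) lo+1<n) 2 (s≤s z≤n))
    where
      lo+1<n : lo + 1 < n
      lo+1<n = ≤-trans (≤-reflexive (sym (+-suc lo 1))) (≤-trans (+-monoʳ-≤ lo 2≤w) fits)
      within₂ : ∀ {u} → InSlab lo w u → u ∈ M × dist (middle (lo + 1) lo+1<n) u ≤ 2
      within₂ {u} (u∈M , lo≤c , c<lo+w) = u∈M , dist-middle lo+1<n u (≤⇒∣-∣≤ left right)
        where
          left : lo + 1 ≤ 1 + col u
          left = subst (_≤ 1 + col u) (+-comm 1 lo) (s≤s lo≤c)
          right : col u ≤ 1 + (lo + 1)
          right = s≤s⁻¹ (≤-trans c<lo+w (≤-trans (+-monoʳ-≤ lo w≤3)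
                                                 (≤-reflexive (trans (+-suc lo 2) (cong suc (+-suc lo 1))))))

  -- Four columns hold at most two vertices of M, by the finite check on P_4 □ P_3.
  module Block (lo : ℕ) (fits : lo + 4 ≤ n) where

    offset< : ∀ {u} → InSlab lo 4 u → col u ∸ lo < 4
    offset< {u} (_ , lo≤c , c<lo+4) = +-cancelˡ-< lo _ 4 (subst (_< lo + 4) (sym (m+[n∸m]≡n lo≤c)) c<lo+4)

    toBlock : (u : Grid3 n) → InSlab lo 4 u → Grid3 4
    toBlock u inSlab = fromℕ< (offset< inSlab) , proj₂ u

    column< : (a : Fin 4) → lo + toℕ a < n
    column< a = ≤-trans (+-monoʳ-< lo (toℕ<n a)) fits

    fromBlock : Grid3 4 → Grid3 n
    fromBlock (a , y) = fromℕ< (column< a) , y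

    toBlock-injective : ∀ {u w} (su : InSlab lo 4 u) (sw : InSlab lo 4 w) → toBlock u su ≡ toBlock w sw → u ≡ w
    toBlock-injective {u} {w} su@(_ , lo≤u , _) sw@(_ , lo≤w , _) eq = grid-≡ same-col (cong row eq)
      where
        same-offset : col u ∸ lo ≡ col w ∸ lo
        same-offset = trans (sym (toℕ-fromℕ< (offset< su))) (trans (cong col eq) (toℕ-fromℕ< (offset< sw)))
        same-col : col u ≡ col w
        same-col = trans (sym (m+[n∸m]≡n lo≤u)) (trans (cong (lo +_) same-offset) (m+[n∸m]≡n lo≤w))

    dist-fromBlock : ∀ c u (su : InSlab lo 4 u) → dist (fromBlock c) u ≡ dist c (toBlock u su)
    dist-fromBlock (a , y) u su@(_ , lo≤c , _) = cong (_+ ∣ toℕ y - row u ∣) (begin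
        ∣ toℕ (fromℕ< (column< a)) - col u ∣     ≡⟨ cong (∣_- col u ∣) (toℕ-fromℕ< (column< a)) ⟩
        ∣ lo + toℕ a - col u ∣                   ≡⟨ cong (∣ lo + toℕ a -_∣) (sym (m+[n∸m]≡n lo≤c)) ⟩
        ∣ lo + toℕ a - lo + (col u ∸ lo) ∣       ≡⟨ ∣m+n-m+o∣≡∣n-o∣ lo (toℕ a) (col u ∸ lo) ⟩
        ∣ toℕ a - col u ∸ lo ∣                   ≡⟨ cong (∣ toℕ a -_∣) (sym (toℕ-fromℕ< (offset< su))) ⟩
        ∣ toℕ a - col (toBlock u su) ∣           ∎)
      where open ≡-Reasoning

    -- Three vertices of M in the block would give a crowded triple of P_4 □ P_3.
    slab₄ : AtMost 2 (InSlab lo 4)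
    slab₄ = at-most-two apart
      where
        apart : ∀ {p q s} → p ≢ q → p ≢ s → q ≢ s → InSlab lo 4 p → InSlab lo 4 q → InSlab lo 4 s → ⊥
        apart {p} {q} {s} p≢q p≢s q≢s sp sq ss = spread (block-crowded (toBlock p sp) (toBlock q sq) (toBlock s ss)
            (λ e → p≢q (toBlock-injective sp sq e)) (λ e → p≢s (toBlock-injective sp ss e))
            (λ e → q≢s (toBlock-injective sq ss e)))
          where
            spread : ∃ (λ c → CrowdedAt c (toBlock p sp) (toBlock q sq) (toBlock s ss)) → ⊥
            spread (c , crowded) = uncrowded p≢q p≢s q≢s (proj₁ sp) (proj₁ sq) (proj₁ ss) (fromBlock c)
              (Crowded-cong (sym (dist-fromBlock c p sp)) (sym (dist-fromBlock c q sq)) (sym (dist-fromBlock c s ss))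
                            crowded)

  slab : ∀ w lo → lo + w ≤ n → AtMost (mpBound w) (InSlab lo w)
  slab 0 lo _ = AtMost-none (λ { {u} (_ , lo≤c , c<lo+0) → <⇒≱ (subst (col u <_) (+-identityʳ lo) c<lo+0) lo≤c })
  slab 1 lo fits = slab₁ lo (subst (_≤ n) (+-comm lo 1) fits)
  slab 2 lo fits = slab₂₃ lo 2 ≤-refl (s≤s (s≤s z≤n)) fits
  slab 3 lo fits = slab₂₃ lo 3 (s≤s (s≤s z≤n)) ≤-refl fits
  slab (suc (suc (suc (suc w)))) lo fits =
    AtMost-split (λ u → lo + 4 ≤? col u)
      (AtMost-weaken (λ { ((u∈M , lo≤c , _) , ¬far) → u∈M , lo≤c , ≰⇒> ¬far }) (Block.slab₄ lo first-block))
      (AtMost-weaken (λ { {u} ((u∈M , _ , c<end) , far) → u∈M , far , subst (col u <_) (sym (+-assoc lo 4 w)) c<end })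
                     (slab w (lo + 4) (subst (_≤ n) (sym (+-assoc lo 4 w)) fits)))
    where
      first-block : lo + 4 ≤ n
      first-block = ≤-trans (+-monoʳ-≤ lo (m≤m+n 4 w)) fits

  upper-bound : length M ≤ mpBound n
  upper-bound = slab n 0 ≤-refl M (proj₁ packing) (All.tabulate (λ {u} u∈M → u∈M , z≤n , toℕ<n (proj₁ u)))

-- The lower bound: the marked vertices

data Kind : Set where
  bottom top : Kind

columnOffset : Kind → ℕ
columnOffset bottom = 0
columnOffset top    = 1

rowOf : Kind → Fin 3
rowOf bottom = zero
rowOf top    = suc (suc zero)

record Marked {n : ℕ} (u : Grid3 n) : Set where
  constructor marked
  field
    kind  : Kind
    index : ℕ
    col≡  : col u ≡ columnOffset kind + index * 4
    row≡  : row u ≡ toℕ (rowOf kind)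
open Marked

marked-≡ : ∀ {n} {p q : Grid3 n} (mp : Marked p) (mq : Marked q) → kind mp ≡ kind mq → index mp ≡ index mq → p ≡ q
marked-≡ (marked κ k c r) (marked .κ .k c' r') refl refl = grid-≡ (trans c (sym c')) (trans r (sym r'))

-- Rotated coordinates: σ and τ change by at most one along each grid step, and a marked
-- vertex of index k has σ = 4k + σOffset and τ = 4k + τOffset.

σ : ∀ {n} → Grid3 n → ℕ
σ u = col u + row u

τ : ∀ {n} → Grid3 n → ℕ
τ u = col u + (2 ∸ row u)

σOffset τOffset : Kind → ℕ
σOffset bottom = 0
σOffset top    = 3
τOffset bottom = 2
τOffset top    = 1

σ-marked : ∀ {n} {u : Grid3 n} (m : Marked u) → σ u ≡ σOffset (kind m) + index m * 4
σ-marked (marked bottom k c r) rewrite c | r = +-identityʳ (k * 4)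
σ-marked (marked top    k c r) rewrite c | r = cong suc (+-comm (k * 4) 2)

τ-marked : ∀ {n} {u : Grid3 n} (m : Marked u) → τ u ≡ τOffset (kind m) + index m * 4
τ-marked (marked bottom k c r) rewrite c | r = +-comm (k * 4) 2
τ-marked (marked top    k c r) rewrite c | r = cong suc (+-identityʳ (k * 4))

∣-∣-+ : ∀ a b c d → ∣ a + b - c + d ∣ ≤ ∣ a - c ∣ + ∣ b - d ∣
∣-∣-+ a b c d = begin
    ∣ a + b - c + d ∣                       ≤⟨ ∣-∣-triangle (a + b) (a + d) (c + d) ⟩
    ∣ a + b - a + d ∣ + ∣ a + d - c + d ∣
      ≡⟨ cong₂ _+_ (∣m+n-m+o∣≡∣n-o∣ a b d) (cong₂ ∣_-_∣ (+-comm a d) (+-comm c d)) ⟩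
    ∣ b - d ∣ + ∣ d + a - d + c ∣           ≡⟨ cong (∣ b - d ∣ +_) (∣m+n-m+o∣≡∣n-o∣ d a c) ⟩
    ∣ b - d ∣ + ∣ a - c ∣                   ≡⟨ +-comm ∣ b - d ∣ ∣ a - c ∣ ⟩
    ∣ a - c ∣ + ∣ b - d ∣                   ∎
  where open ≤-Reasoning

∣2∸-2∸∣ : (y y' : Fin 3) → ∣ (2 ∸ toℕ y) - (2 ∸ toℕ y') ∣ ≡ ∣ toℕ y - toℕ y' ∣
∣2∸-2∸∣ zero             zero             = refl
∣2∸-2∸∣ zero             (suc zero)       = refl
∣2∸-2∸∣ zero             (suc (suc zero)) = refl
∣2∸-2∸∣ (suc zero)       zero             = refl
∣2∸-2∸∣ (suc zero)       (suc zero)       = refl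
∣2∸-2∸∣ (suc zero)       (suc (suc zero)) = refl
∣2∸-2∸∣ (suc (suc zero)) zero             = refl
∣2∸-2∸∣ (suc (suc zero)) (suc zero)       = refl
∣2∸-2∸∣ (suc (suc zero)) (suc (suc zero)) = refl

record InBox {n : ℕ} (r S T : ℕ) (u : Grid3 n) : Set where
  constructor box
  field
    σ-near : ∣ S - σ u ∣ ≤ r
    τ-near : ∣ T - τ u ∣ ≤ r

within⇒box : ∀ {n r} {v u : Grid3 n} → WithinDist (Grid3Adj n) r v u → InBox r (σ v) (τ v) u
within⇒box {r = r} {v} {u} walk = box
    (≤-trans (∣-∣-+ (col v) (row v) (col u) (row u)) d≤r)
    (≤-trans (∣-∣-+ (col v) (2 ∸ row v) (col u) (2 ∸ row u))
            (subst (_≤ r) (cong (∣ col v - col u ∣ +_) (sym (∣2∸-2∸∣ (proj₂ v) (proj₂ u)))) d≤r))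
  where
    d≤r : dist v u ≤ r
    d≤r = within⇒dist walk

index-≤ : ∀ {k k' b} → k * 4 ≤ b + k' * 4 → b ≤ 3 → k ≤ k'
index-≤ {k} {k'} {b} h b≤3 = s≤s⁻¹ (*-cancelʳ-< 4 k (suc k') (s≤s (≤-trans h (+-monoˡ-≤ (k' * 4) b≤3))))

cancel-offset : ∀ a {x y b} → a + x ≤ b + (a + y) → x ≤ b + y
cancel-offset a {x} {y} {b} h = +-cancelˡ-≤ a x (b + y) (subst (a + x ≤_) (swap b a y) h)
  where
    swap : ∀ b a y → b + (a + y) ≡ a + (b + y)
    swap = solve-∀

escape : ∀ {S x r} → ∣ S - x ∣ ≤ 2 + r → ¬ ∣ (2 + S) - x ∣ ≤ r → (2 + r) + x ≤ 3 + S
escape {S} {x} {r} near far = s≤s (≰⇒> (λ 2+S≤r+x → far (≤⇒∣-∣≤ 2+S≤r+x x≤r+2+S)))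
  where
    x≤r+2+S : x ≤ r + (2 + S)
    x≤r+2+S = subst (x ≤_) (reassoc r S) (∣-∣≤⇒≥ {S} near)
      where
        reassoc : ∀ r S → 2 + r + S ≡ r + (2 + S)
        reassoc = solve-∀

kind-cases : (κ κ' : Kind) → κ ≡ κ' ⊎ (κ ≡ bottom × κ' ≡ top) ⊎ (κ ≡ top × κ' ≡ bottom)
kind-cases bottom bottom = inj₁ refl
kind-cases bottom top    = inj₂ (inj₁ (refl , refl))
kind-cases top    bottom = inj₂ (inj₂ (refl , refl))
kind-cases top    top    = inj₁ refl

kind-triple : (a b c : Kind) → (a ≡ b × a ≡ c) ⊎ (a ≡ b × a ≢ c) ⊎ (a ≡ c × a ≢ b) ⊎ (b ≡ c × b ≢ a)
kind-triple bottom bottom bottom = inj₁ (refl , refl)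
kind-triple bottom bottom top    = inj₂ (inj₁ (refl , λ ()))
kind-triple bottom top    bottom = inj₂ (inj₂ (inj₁ (refl , λ ())))
kind-triple bottom top    top    = inj₂ (inj₂ (inj₂ (refl , λ ())))
kind-triple top    bottom bottom = inj₂ (inj₂ (inj₂ (refl , λ ())))
kind-triple top    bottom top    = inj₂ (inj₂ (inj₁ (refl , λ ())))
kind-triple top    top    bottom = inj₂ (inj₁ (refl , λ ()))
kind-triple top    top    top    = inj₁ (refl , refl)

Adjacent : ℕ → ℕ → Set
Adjacent a b = a ≤ suc b × b ≤ suc a

adjacent-distinct : ∀ {a b} → a ≢ b → Adjacent a b → a ≡ suc b ⊎ b ≡ suc a
adjacent-distinct {a} {b} a≢b (a≤1+b , b≤1+a) with <-cmp a b
... | tri< a<b _ _   = inj₂ (≤-antisym b≤1+a a<b)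
... | tri≈ _ a≡b _   = ⊥-elim (a≢b a≡b)
... | tri> _ _ b<a   = inj₁ (≤-antisym a≤1+b b<a)

no-three-adjacent : ∀ {a b c} → a ≢ b → a ≢ c → b ≢ c → Adjacent a b → Adjacent a c → Adjacent b c → ⊥
no-three-adjacent a≢b a≢c b≢c ab ac bc with adjacent-distinct a≢b ab | adjacent-distinct a≢c ac
... | inj₁ refl | inj₁ a≡1+c = b≢c (suc-injective a≡1+c)
... | inj₁ refl | inj₂ refl   = 1+n≰n (proj₂ bc)
... | inj₂ refl | inj₁ refl   = 1+n≰n (proj₁ bc)
... | inj₂ refl | inj₂ refl   = b≢c refl

module _ {n : ℕ} where

  same-kind-σ : ∀ {p q : Grid3 n} {d} (mp : Marked p) (mq : Marked q) → kind mp ≡ kind mq →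
                σ p ≤ d + σ q → index mp * 4 ≤ d + index mq * 4
  same-kind-σ {d = d} mp@(marked κ _ _ _) mq refl h =
    cancel-offset (σOffset κ) {y = index mq * 4} {b = d} (subst₂ _≤_ (σ-marked mp) (cong (d +_) (σ-marked mq)) h)

  same-kind-τ : ∀ {p q : Grid3 n} {d} (mp : Marked p) (mq : Marked q) → kind mp ≡ kind mq →
                τ p ≤ d + τ q → index mp * 4 ≤ d + index mq * 4
  same-kind-τ {d = d} mp@(marked κ _ _ _) mq refl h =
    cancel-offset (τOffset κ) {y = index mq * 4} {b = d} (subst₂ _≤_ (τ-marked mp) (cong (d +_) (τ-marked mq)) h)

  -- p does not lie a whole block beyond q in both rotated coordinates.
  Below : Grid3 n → Grid3 n → Set
  Below p q = σ p ≤ 3 + σ q ⊎ τ p ≤ 3 + τ q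

  same-kind-≤ : ∀ {p q : Grid3 n} (mp : Marked p) (mq : Marked q) → kind mp ≡ kind mq →
                Below p q → index mp ≤ index mq
  same-kind-≤ mp mq same (inj₁ h) = index-≤ (same-kind-σ mp mq same h) ≤-refl
  same-kind-≤ mp mq same (inj₂ h) = index-≤ (same-kind-τ mp mq same h) ≤-refl

  same-kind-≡ : ∀ {p q : Grid3 n} (mp : Marked p) (mq : Marked q) → kind mp ≡ kind mq →
                Below p q → Below q p → p ≡ q
  same-kind-≡ mp mq same pq qp =
    marked-≡ mp mq same (≤-antisym (same-kind-≤ mp mq same pq) (same-kind-≤ mq mp (sym same) qp))

  index-≢ : ∀ {p q : Grid3 n} (mp : Marked p) (mq : Marked q) → kind mp ≡ kind mq → p ≢ q → index mp ≢ index mq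
  index-≢ mp mq same p≢q e = p≢q (marked-≡ mp mq same e)

  box-spread : ∀ {r S T} {p q : Grid3 n} → InBox r S T p → InBox r S T q →
               σ p ≤ (r + r) + σ q × τ p ≤ (r + r) + τ q
  box-spread {r} {S} {T} (box σp τp) (box σq τq) = spread S σp σq , spread T τp τq
    where
      spread : ∀ C {x y} → ∣ C - x ∣ ≤ r → ∣ C - y ∣ ≤ r → x ≤ (r + r) + y
      spread C {x} {y} hx hy =
        ≤-trans (∣-∣≤⇒≥ {C} {x} hx)
                (≤-trans (+-monoʳ-≤ r (∣-∣≤⇒≤ {C} {y} hy)) (≤-reflexive (sym (+-assoc r r y))))

  σ-spread : ∀ {r S T} {p q : Grid3 n} (mp : Marked p) (mq : Marked q) → InBox r S T p → InBox r S T q →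
             σOffset (kind mp) + index mp * 4 ≤ (r + r) + (σOffset (kind mq) + index mq * 4)
  σ-spread {r} mp mq bp bq = subst₂ _≤_ (σ-marked mp) (cong ((r + r) +_) (σ-marked mq)) (proj₁ (box-spread bp bq))

  τ-spread : ∀ {r S T} {p q : Grid3 n} (mp : Marked p) (mq : Marked q) → InBox r S T p → InBox r S T q →
             τOffset (kind mp) + index mp * 4 ≤ (r + r) + (τOffset (kind mq) + index mq * 4)
  τ-spread {r} mp mq bp bq = subst₂ _≤_ (τ-marked mp) (cong ((r + r) +_) (τ-marked mq)) (proj₂ (box-spread bp bq))

  MarkedIn : ℕ → ℕ → ℕ → Grid3 n → Set
  MarkedIn r S T u = Marked u × InBox r S T u

  -- Radius 1: no two distinct marked vertices share a box. For a bottom vertex of index k and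
  -- a top vertex of index k', σ forces k' < k and τ forces k ≤ k'.
  cross₁ : ∀ {S T} {p q : Grid3 n} (mp : Marked p) (mq : Marked q) → kind mp ≡ bottom → kind mq ≡ top →
           InBox 1 S T p → InBox 1 S T q → ⊥
  cross₁ mp@(marked bottom k _ _) mq@(marked top k' _ _) refl refl bp bq = 1+n≰n (≤-trans k'<k k≤k')
    where
      k'<k : suc k' ≤ k
      k'<k = index-≤ (s≤s (σ-spread mq mp bq bp)) ≤-refl
      k≤k' : k ≤ k'
      k≤k' = index-≤ (+-cancelˡ-≤ 2 _ _ (τ-spread mp mq bp bq)) (s≤s z≤n)

  box₁-below : ∀ {S T} {p q : Grid3 n} → InBox 1 S T p → InBox 1 S T q → Below p q
  box₁-below bp bq = inj₁ (≤-trans (proj₁ (box-spread bp bq)) (n≤1+n _))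

  no-pair₁ : ∀ {S T} {p q : Grid3 n} → p ≢ q → MarkedIn 1 S T p → MarkedIn 1 S T q → ⊥
  no-pair₁ p≢q (mp , bp) (mq , bq) with kind-cases (kind mp) (kind mq)
  ... | inj₁ same           = p≢q (same-kind-≡ mp mq same (box₁-below bp bq) (box₁-below bq bp))
  ... | inj₂ (inj₁ (b , t)) = cross₁ mp mq b t bp bq
  ... | inj₂ (inj₂ (t , b)) = cross₁ mq mp b t bq bp

  cross₂ : ∀ {S T} {p q : Grid3 n} (mp : Marked p) (mq : Marked q) → kind mp ≡ bottom → kind mq ≡ top →
           InBox 2 S T p → InBox 2 S T q → index mp ≡ index mq
  cross₂ mp@(marked bottom k _ _) mq@(marked top k' _ _) refl refl bp bq = ≤-antisym k≤k' k'≤k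
    where
      k≤k' : k ≤ k'
      k≤k' = index-≤ (+-cancelˡ-≤ 2 _ _ (τ-spread mp mq bp bq)) ≤-refl
      k'≤k : k' ≤ k
      k'≤k = index-≤ (+-cancelˡ-≤ 3 _ _ (σ-spread mq mp bq bp)) (s≤s z≤n)

  cross-index₂ : ∀ {S T} {p q : Grid3 n} (mp : Marked p) (mq : Marked q) → kind mp ≢ kind mq →
                 InBox 2 S T p → InBox 2 S T q → index mp ≡ index mq
  cross-index₂ mp mq differ bp bq with kind-cases (kind mp) (kind mq)
  ... | inj₁ same          = ⊥-elim (differ same)
  ... | inj₂ (inj₁ (b , t)) = cross₂ mp mq b t bp bq
  ... | inj₂ (inj₂ (t , b)) = sym (cross₂ mq mp b t bq bp)

  same-kind-adjacent₂ : ∀ {S T} {p q : Grid3 n} (mp : Marked p) (mq : Marked q) → kind mp ≡ kind mq →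
                        InBox 2 S T p → InBox 2 S T q → Adjacent (index mp) (index mq)
  same-kind-adjacent₂ mp mq same bp bq =
      index-≤ (same-kind-σ mp mq same (proj₁ (box-spread bp bq))) z≤n
    , index-≤ (same-kind-σ mq mp (sym same) (proj₁ (box-spread bq bp))) z≤n

  -- Two distinct vertices of one kind and a third of the other kind do not fit in a box of
  -- radius 2, since all three indices would agree.
  odd-one-out : ∀ {S T} {x y z : Grid3 n} → x ≢ y → (mx : Marked x) (my : Marked y) (mz : Marked z) →
                kind mx ≡ kind my → kind mx ≢ kind mz → InBox 2 S T x → InBox 2 S T y → InBox 2 S T z → ⊥
  odd-one-out x≢y mx my mz same differ bx by bz =
    x≢y (marked-≡ mx my same (trans (cross-index₂ mx mz differ bx bz)
                                     (sym (cross-index₂ my mz (λ e → differ (trans same e)) by bz))))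

  -- Radius 2: no three distinct marked vertices share a box; three of one kind would have
  -- pairwise adjacent distinct indices.
  no-triple₂ : ∀ {S T} {p q s : Grid3 n} → p ≢ q → p ≢ s → q ≢ s →
               MarkedIn 2 S T p → MarkedIn 2 S T q → MarkedIn 2 S T s → ⊥
  no-triple₂ p≢q p≢s q≢s (mp , bp) (mq , bq) (ms , bs) with kind-triple (kind mp) (kind mq) (kind ms)
  ... | inj₁ (pq , ps) =
    no-three-adjacent (index-≢ mp mq pq p≢q) (index-≢ mp ms ps p≢s) (index-≢ mq ms (trans (sym pq) ps) q≢s)
      (same-kind-adjacent₂ mp mq pq bp bq) (same-kind-adjacent₂ mp ms ps bp bs)
      (same-kind-adjacent₂ mq ms (trans (sym pq) ps) bq bs)
  ... | inj₂ (inj₁ (pq , p≁s))       = odd-one-out p≢q mp mq ms pq p≁s bp bq bs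
  ... | inj₂ (inj₂ (inj₁ (ps , p≁q))) = odd-one-out p≢s mp ms mq ps p≁q bp bs bq
  ... | inj₂ (inj₂ (inj₂ (qs , q≁p))) = odd-one-out q≢s mq ms mp qs q≁p bq bs bp

  data Fringe (R S T : ℕ) (u : Grid3 n) : Set where
    σ-side : R + σ u ≤ 3 + S → Fringe R S T u
    τ-side : R + τ u ≤ 3 + T → Fringe R S T u

  fringe-below : ∀ {R S T} {p q : Grid3 n} → Fringe R S T p → InBox R S T q → Below p q
  fringe-below {R} {S} {q = q} (σ-side h) (box σq _) =
    inj₁ (cancel-offset R {y = σ q} {b = 3} (≤-trans h (+-monoʳ-≤ 3 (∣-∣≤⇒≤ {S} σq))))
  fringe-below {R} {T = T} {q = q} (τ-side h) (box _ τq) =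
    inj₂ (cancel-offset R {y = τ q} {b = 3} (≤-trans h (+-monoʳ-≤ 3 (∣-∣≤⇒≤ {T} τq))))

  -- So the fringe holds at most one marked vertex of each kind.
  fringe-two : ∀ {R S T} → AtMost 2 (λ u → MarkedIn R S T u × Fringe R S T u)
  fringe-two {R} {S} {T} = at-most-two apart
    where
      apart : ∀ {p q s : Grid3 n} → p ≢ q → p ≢ s → q ≢ s → MarkedIn R S T p × Fringe R S T p →
              MarkedIn R S T q × Fringe R S T q → MarkedIn R S T s × Fringe R S T s → ⊥
      apart p≢q p≢s q≢s ((mp , bp) , fp) ((mq , bq) , fq) ((ms , bs) , fs)
        with kind-triple (kind mp) (kind mq) (kind ms)
      ... | inj₁ (pq , _)               = p≢q (same-kind-≡ mp mq pq (fringe-below fp bq) (fringe-below fq bp))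
      ... | inj₂ (inj₁ (pq , _))        = p≢q (same-kind-≡ mp mq pq (fringe-below fp bq) (fringe-below fq bp))
      ... | inj₂ (inj₂ (inj₁ (ps , _))) = p≢s (same-kind-≡ mp ms ps (fringe-below fp bs) (fringe-below fs bp))
      ... | inj₂ (inj₂ (inj₂ (qs , _))) = q≢s (same-kind-≡ mq ms qs (fringe-below fq bs) (fringe-below fs bq))

  fringe : ∀ {r S T} {u : Grid3 n} → InBox (2 + r) S T u → ¬ InBox r (2 + S) (2 + T) u → Fringe (2 + r) S T u
  fringe {r} {S} {T} {u} (box σu τu) outside with ∣ (2 + S) - σ u ∣ ≤? r
  ... | yes σ-inner = τ-side (escape τu (λ τ-inner → outside (box σ-inner τ-inner)))
  ... | no  σ-outer = σ-side (escape σu σ-outer)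

  -- The box of radius r ≥ 1 holds at most r marked vertices: induction on r in steps of two,
  -- splitting the box into the inner box and the fringe.
  box-bound : ∀ r → 1 ≤ r → ∀ S T → AtMost r (MarkedIn r S T)
  box-bound 1 _ S T = at-most-one no-pair₁
  box-bound 2 _ S T = at-most-two no-triple₂
  box-bound (suc (suc (suc r))) _ S T =
    AtMost-split inner?
      (AtMost-weaken (λ { ((m , b) , outside) → (m , b) , fringe b outside }) fringe-two)
      (AtMost-weaken (λ { ((m , _) , inside) → m , inside }) (box-bound (suc r) (s≤s z≤n) (2 + S) (2 + T)))
    where
      inner? : Decidable (InBox (suc r) (2 + S) (2 + T))
      inner? u = map′ (λ (σ-in , τ-in) → box σ-in τ-in) (λ (box σ-in τ-in) → σ-in , τ-in)
                      (∣ (2 + S) - σ u ∣ ≤? suc r ×-dec ∣ (2 + T) - τ u ∣ ≤? suc r)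

module Construction {n : ℕ} where

  markAt : (κ : Kind) (k : ℕ) → columnOffset κ + k * 4 < n → Grid3 n
  markAt κ k exists = fromℕ< exists , rowOf κ

  markAt-col : ∀ κ k exists → col (markAt κ k exists) ≡ columnOffset κ + k * 4
  markAt-col κ k exists = toℕ-fromℕ< exists

  markAt-precedes : ∀ κ k exists {u : Grid3 n} → suc k * 4 ≤ col u → markAt κ k exists ≢ u
  markAt-precedes κ k exists beyond refl =
    <⇒≱ (subst (_< suc k * 4) (sym (markAt-col κ k exists)) (+-monoˡ-< (k * 4) (offset<4 κ))) beyond
    where
      offset<4 : ∀ κ → columnOffset κ < 4
      offset<4 bottom = s≤s z≤n
      offset<4 top    = s≤s (s≤s z≤n)

  column-exists : ∀ {k w a} → a < w → k * 4 + w ≤ n → a + k * 4 < n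
  column-exists {k} {w} {a} a<w room =
    ≤-trans (subst (λ c → suc c ≤ k * 4 + w) (+-comm (k * 4) a) (+-monoʳ-< (k * 4) a<w)) room

  bottom-exists : ∀ k {w} → k * 4 + suc w ≤ n → columnOffset bottom + k * 4 < n
  bottom-exists k = column-exists {k} (s≤s z≤n)

  top-exists : ∀ k {w} → k * 4 + suc (suc w) ≤ n → columnOffset top + k * 4 < n
  top-exists k = column-exists {k} (s≤s (s≤s z≤n))

  bottomAt : ∀ k {w} → k * 4 + suc w ≤ n → Grid3 n
  bottomAt k room = markAt bottom k (bottom-exists k room)

  topAt : ∀ k {w} → k * 4 + suc (suc w) ≤ n → Grid3 n
  topAt k room = markAt top k (top-exists k room)

  bottomAt-marked : ∀ k {w} (room : k * 4 + suc w ≤ n) → Marked (bottomAt k room)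
  bottomAt-marked k room = marked bottom k (markAt-col bottom k (bottom-exists k room)) refl

  topAt-marked : ∀ k {w} (room : k * 4 + suc (suc w) ≤ n) → Marked (topAt k room)
  topAt-marked k room = marked top k (markAt-col top k (top-exists k room)) refl

  next-block : ∀ k {w} → k * 4 + (4 + w) ≤ n → suc k * 4 + w ≤ n
  next-block k {w} = subst (_≤ n) (reassoc (k * 4) w)
    where
      reassoc : ∀ a w → a + (4 + w) ≡ 4 + a + w
      reassoc = solve-∀

  build : ∀ k w → k * 4 + w ≤ n → List (Grid3 n)
  build k 0 _                              = []
  build k 1 room                           = bottomAt k room ∷ []
  build k 2 room                           = bottomAt k room ∷ topAt k room ∷ []
  build k 3 room                           = bottomAt k room ∷ topAt k room ∷ []
  build k (suc (suc (suc (suc w)))) room   = bottomAt k room ∷ topAt k room ∷ build (suc k) w (next-block k room)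

  build-length : ∀ k w room → length (build k w room) ≡ mpBound w
  build-length k 0 _                            = refl
  build-length k 1 _                            = refl
  build-length k 2 _                            = refl
  build-length k 3 _                            = refl
  build-length k (suc (suc (suc (suc w)))) room = cong (2 +_) (build-length (suc k) w (next-block k room))

  build-marked : ∀ k w room → All Marked (build k w room)
  build-marked k 0 _                            = []
  build-marked k 1 room                         = bottomAt-marked k room ∷ []
  build-marked k 2 room                         = bottomAt-marked k room ∷ topAt-marked k room ∷ []
  build-marked k 3 room                         = bottomAt-marked k room ∷ topAt-marked k room ∷ []
  build-marked k (suc (suc (suc (suc w)))) room =
    bottomAt-marked k room ∷ topAt-marked k room ∷ build-marked (suc k) w (next-block k room)

  bottom≥ : ∀ k {w} (room : k * 4 + suc w ≤ n) → k * 4 ≤ col (bottomAt k room)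
  bottom≥ k room = ≤-reflexive (sym (markAt-col bottom k (bottom-exists k room)))
  top≥ : ∀ k {w} (room : k * 4 + suc (suc w) ≤ n) → k * 4 ≤ col (topAt k room)
  top≥ k room = subst (k * 4 ≤_) (sym (markAt-col top k (top-exists k room))) (n≤1+n (k * 4))

  build-columns : ∀ k w room → All (λ u → k * 4 ≤ col u) (build k w room)
  build-columns k 0 _                            = []
  build-columns k 1 room                         = bottom≥ k room ∷ []
  build-columns k 2 room                         = bottom≥ k room ∷ top≥ k room ∷ []
  build-columns k 3 room                         = bottom≥ k room ∷ top≥ k room ∷ []
  build-columns k (suc (suc (suc (suc w)))) room =
    bottom≥ k room ∷ top≥ k room ∷ All.map (≤-trans (m≤n+m (k * 4) 4)) (build-columns (suc k) w (next-block k room))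

  build-unique : ∀ k w room → Unique (build k w room)
  build-unique k 0 _                            = []
  build-unique k 1 room                         = [] ∷ []
  build-unique k 2 room                         = ((λ ()) ∷ []) ∷ [] ∷ []
  build-unique k 3 room                         = ((λ ()) ∷ []) ∷ [] ∷ []
  build-unique k (suc (suc (suc (suc w)))) room =
      ((λ ()) ∷ All.map (markAt-precedes bottom k (bottom-exists k room)) later)
    ∷ All.map (markAt-precedes top k (top-exists k room)) later
    ∷ build-unique (suc k) w (next-block k room)
    where
      later : All (λ u → suc k * 4 ≤ col u) (build (suc k) w (next-block k room))
      later = build-columns (suc k) w (next-block k room)

  marked-list : List (Grid3 n)
  marked-list = build 0 n ≤-refl

  -- Every ball of radius r lies in a box of radius r, which holds at most r marked vertices.
  marked-multipacking : IsMultipacking (Grid3Adj n) marked-list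
  marked-multipacking = build-unique 0 n ≤-refl , λ v r 1≤r →
    AtMost-weaken (λ { (u∈M , walk) → All.lookup (build-marked 0 n ≤-refl) u∈M , within⇒box walk })
                  (box-bound r 1≤r (σ v) (τ v))

-- The value of mpBound in closed form: each block of four columns adds 2 to both sides.

mpBound-closed : ∀ n → (n % 4 ≡ 0 → mpBound n ≡ n / 2) × (n % 4 ≢ 0 → mpBound n ≡ n / 2 + 1)
mpBound-closed 0 = (λ _ → refl) , (λ 0≢0 → ⊥-elim (0≢0 refl))
mpBound-closed 1 = (λ ()) , (λ _ → refl)
mpBound-closed 2 = (λ ()) , (λ _ → refl)
mpBound-closed 3 = (λ ()) , (λ _ → refl)
mpBound-closed (suc (suc (suc (suc m)))) =
    (λ 4∣ → trans (cong (2 +_) (proj₁ (mpBound-closed m) (trans (sym mod) 4∣))) (sym half))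
  , (λ 4∤ → trans (cong (2 +_) (proj₂ (mpBound-closed m) (λ 4∣m → 4∤ (trans mod 4∣m)))) (cong (_+ 1) (sym half)))
  where
    mod : (4 + m) % 4 ≡ m % 4
    mod = trans (cong (_% 4) (+-comm 4 m)) ([m+n]%n≡m%n m 4)
    half : (4 + m) / 2 ≡ 2 + m / 2
    half = trans (m/n≡1+[m∸n]/n {4 + m} {2} (s≤s (s≤s z≤n)))
                 (cong suc (m/n≡1+[m∸n]/n {2 + m} {2} (s≤s (s≤s z≤n))))

mp-grid : ∀ n → MpIs (Grid3Adj n) (mpBound n)
mp-grid n = (marked-list , marked-multipacking , build-length 0 n ≤-refl) , UpperBound.upper-bound
  where open Construction {n}

proposition2 : (n : ℕ) → 1 ≤ n →
    ((n % 4 ≡ 0) → MpIs (Grid3Adj n) (n / 2)) ×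
    ((n % 4 ≢ 0) → MpIs (Grid3Adj n) (n / 2 + 1))
proposition2 n _ =
    (λ 4∣n → subst (MpIs (Grid3Adj n)) (proj₁ (mpBound-closed n) 4∣n) (mp-grid n))
  , (λ 4∤n → subst (MpIs (Grid3Adj n)) (proj₂ (mpBound-closed n) 4∤n) (mp-grid n))
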